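{- Let $G=(V,E)$ be a graph with $n$ vertices, with modified adjacency matrix $A$ and initial-state vector $B$ as in the context, and suppose the system $AU=B$ has a solution over $\mathbb{F}_2$. Let $\mathrm{sol}$ be the value (number of ones) of the solution returned by Algorithm GreedyEchelon on input $(A,B)$, and let $\mathrm{opt}$ be the minimum value of a solution $U\in\mathbb{F}_2^n$ of $AU=B$. Then $\mathrm{sol}\le (n+\mathrm{opt})/2$.
   Context: Generalized all-ones problem. Let $G=(V,E)$ be a graph with $V=\{v_1,\dots,v_n\}$. Each vertex carries a lamp (on or off) and a button of $\sigma^+$-type or $\sigma$-type. Pressing a $\sigma^+$-type button at $x$ toggles the lamps at $x$ and at all neighbours of $x$; pressing a $\sigma$-type button at $x$ toggles only the lamps at the neighbours of $x$. The modified adjacency matrix $A=(a_{ij})$ is the $n\times n$ matrix over $\mathbb{F}_2$ with, for $i\ne j$, $a_{ij}=1$ iff $v_iv_j\in E$, and $a_{ii}=1$ iff the button at $v_i$ is of $\sigma^+$-type. The vector $B=(b_1,\dots,b_n)^T\in\mathbb{F}_2^n$ has $b_i=1$ iff the lamp at $v_i$ is initially off. A solution is a vector $U\in\mathbb{F}_2^n$ with $AU=B$ (pressing the buttons at $\{v_i:u_i=1\}$ turns all lamps on); its value is its number of ones $\sum_i u_i$. Algorithm GreedyEchelon on input $(A,B)$: (1) Solve $AU=B$ over $\mathbb{F}_2$: if it has no solution, return "no solution"; otherwise compute a particular solution $\gamma$ and an $n\times m$ matrix $\eta$ whose columns form a basis of the null space of $A$, $m=n-\operatorname{rank}A$. If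 $m=0$ return $\gamma$. (2) Find an $n\times n$ permutation matrix $P$ and an invertible $m\times m$ matrix $Q$ such that $\varepsilon=P\eta Q$ is in column echelon form: there are indices $0\le k_0<k_1<\dots<k_m=n$ such that rows $1,\dots,k_0$ of $\varepsilon$ are zero and, for each $i=1,\dots,m$, every row $j$ with $k_{i-1}<j\le k_i$ has $\varepsilon_{ji}=1$ and $\varepsilon_{jp}=0$ for all $p>i$. Set $\gamma'=P\gamma$. (3) For $i=1,\dots,m$ in order: for each $j$ with $k_{i-1}<j\le k_i$ let $c_j=\gamma'_j+\sum_{p<i}\varepsilon_{jp}z_p$ (over $\mathbb{F}_2$); if the number of $j$ in this range with $c_j=1$ is at most $(k_i-k_{i-1})/2$ set $z_i=0$, otherwise set $z_i=1$. (4) Return $U=P^{ -1}(\varepsilon z+\gamma')$, which is a solution of $AU=B$. -}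

module Defs where

open import Data.Bool using (Bool; true; false; _∧_; _xor_; if_then_else_)
open import Data.Nat using (ℕ; zero; suc; _+_; _*_; _∸_; _≤_; _<_; _<ᵇ_; _≤ᵇ_)
open import Data.Fin using (Fin; zero; suc; toℕ; _≟_)
open import Data.Fin.Permutation using (Permutation′; _⟨$⟩ʳ_; _⟨$⟩ˡ_)
open import Data.Product using (Σ; ∃; _×_; _,_)
open import Relation.Nullary.Decidable using (⌊_⌋)
open import Relation.Binary.PropositionalEquality using (_≡_)

-- 𝔽₂ is modelled by Bool: addition = xor, multiplication = ∧.
-- Vectors over 𝔽₂ of length n: Fin n → Bool.  Matrices: Fin r → Fin c → Bool.

Σ⊕ : ∀ {n} → (Fin n → Bool) → Bool
Σ⊕ {zero}  f = false
Σ⊕ {suc n} f = f zero xor Σ⊕ (λ i → f (suc i))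

count : ∀ {n} → (Fin n → Bool) → ℕ
count {zero}  f = 0
count {suc n} f = (if f zero then 1 else 0) + count (λ i → f (suc i))

value : ∀ {n} → (Fin n → Bool) → ℕ
value = count

_·v_ : ∀ {r c} → (Fin r → Fin c → Bool) → (Fin c → Bool) → Fin r → Bool
(M ·v x) i = Σ⊕ (λ j → M i j ∧ x j)

_·M_ : ∀ {r s c} → (Fin r → Fin s → Bool) → (Fin s → Fin c → Bool) → Fin r → Fin c → Bool
(M ·M N) i j = Σ⊕ (λ l → M i l ∧ N l j)

idM : ∀ {n} → Fin n → Fin n → Bool
idM i j = ⌊ i ≟ j ⌋

_≐_ : ∀ {n} → (Fin n → Bool) → (Fin n → Bool) → Set
x ≐ y = ∀ i → x i ≡ y i

-- A (simple, undirected, loopless) graph on vertex set Fin n, together with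
-- the button types: button v ≡ true iff the button at v is of σ⁺-type.
record LampGraph (n : ℕ) : Set where
  field
    adj    : Fin n → Fin n → Bool
    symm   : ∀ i j → adj i j ≡ adj j i
    irrefl : ∀ i → adj i i ≡ false
    button : Fin n → Bool

modAdj : ∀ {n} → LampGraph n → Fin n → Fin n → Bool
modAdj G i j = if ⌊ i ≟ j ⌋ then LampGraph.button G i else LampGraph.adj G i j

IsSolution : ∀ {n} → (Fin n → Fin n → Bool) → (Fin n → Bool) → (Fin n → Bool) → Set
IsSolution A B U = (A ·v U) ≐ B

IsNullBasis : ∀ {n m} → (Fin n → Fin n → Bool) → (Fin n → Fin m → Bool) → Set
IsNullBasis {n} {m} A η =
    (∀ (c : Fin m) → (A ·v (λ j → η j c)) ≐ (λ _ → false))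
  × (∀ (x : Fin n → Bool) → (A ·v x) ≐ (λ _ → false) → Σ (Fin m → Bool) (λ y → x ≐ (η ·v y)))
  × (∀ (y : Fin m → Bool) → (η ·v y) ≐ (λ _ → false) → y ≐ (λ _ → false))

Invertible : ∀ {m} → (Fin m → Fin m → Bool) → Set
Invertible {m} Q = Σ (Fin m → Fin m → Bool) (λ Q' →
  (∀ i j → (Q ·M Q') i j ≡ idM i j) × (∀ i j → (Q' ·M Q) i j ≡ idM i j))

-- Permuted matrix: P η where P is the permutation matrix with P r (π r) = 1,
-- so (P η) r = η (π r).   Permuted vector likewise; P⁻¹ w = w ∘ π⁻¹.
permRows : ∀ {n m} → Permutation′ n → (Fin n → Fin m → Bool) → Fin n → Fin m → Bool
permRows π η r c = η (π ⟨$⟩ʳ r) c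

permVec : ∀ {n} → Permutation′ n → (Fin n → Bool) → Fin n → Bool
permVec π γ r = γ (π ⟨$⟩ʳ r)

unpermVec : ∀ {n} → Permutation′ n → (Fin n → Bool) → Fin n → Bool
unpermVec π w s = w (π ⟨$⟩ˡ s)

-- Column echelon form with indices k 0 < k 1 < … < k m = n (rows/columns are
-- 0-based here: paper row j ↔ toℕ r = j-1, paper column i ↔ toℕ c = i-1).
IsColEchelon : ∀ {n m} → (Fin n → Fin m → Bool) → (ℕ → ℕ) → Set
IsColEchelon {n} {m} ε k =
    (∀ i → i < m → k i < k (suc i))
  × (k m ≡ n)
  × (∀ (r : Fin n) → toℕ r < k 0 → ∀ p → ε r p ≡ false)
  × (∀ (c : Fin m) (r : Fin n) → k (toℕ c) ≤ toℕ r → toℕ r < k (suc (toℕ c)) →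
        (ε r c ≡ true) × (∀ (p : Fin m) → toℕ c < toℕ p → ε r p ≡ false))

inBlock : ∀ {n m} → (ℕ → ℕ) → Fin m → Fin n → Bool
inBlock k c r = (k (toℕ c) ≤ᵇ toℕ r) ∧ (toℕ r <ᵇ k (suc (toℕ c)))

greedyC : ∀ {n m} → (Fin n → Fin m → Bool) → (Fin n → Bool) → (Fin m → Bool) → Fin m → Fin n → Bool
greedyC ε γ' z c r = γ' r xor Σ⊕ (λ p → (toℕ p <ᵇ toℕ c) ∧ (ε r p ∧ z p))

-- Step (3): z_c = 0 iff #{r in block c : c_r = 1} ≤ (block size)/2,
-- i.e. z_c = 1 iff block size < 2 · #{…}.
IsGreedyChoice : ∀ {n m} → (Fin n → Fin m → Bool) → (ℕ → ℕ) → (Fin n → Bool) → (Fin m → Bool) → Set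
IsGreedyChoice ε k γ' z =
  ∀ c → z c ≡ ((k (suc (toℕ c)) ∸ k (toℕ c)) <ᵇ (2 * count (λ r → inBlock k c r ∧ greedyC ε γ' z c r)))

greedyOutput : ∀ {n m} → Permutation′ n → (Fin n → Fin m → Bool) → (Fin n → Bool) → (Fin m → Bool) → Fin n → Bool
greedyOutput π ε γ' z = unpermVec π (λ r → (ε ·v z) r xor γ' r)

{-# OPTIONS --safe #-}

-- Let w = εz + γ' be the permuted output and V' = PV for an optimal solution V.  The rows
-- before k₀ are zero rows of ε = PηQ, hence (Q being invertible) zero rows of Pη: every null
-- vector, and so every difference of two solutions, vanishes there, and w agrees with V' on
-- these k₀ rows.  On block i the output is w_j = c_j ⊕ z_i, and the greedy choice of z_i
-- leaves at most half of the block equal to 1.  Summing,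
--   2·sol ≤ 2·#{j < k₀ : V'_j = 1} + (n − k₀) ≤ k₀ + opt + (n − k₀).

module Submission where

open import Defs
open import Algebra.Bundles using (CommutativeRing)
import Algebra.Properties.CommutativeMonoid.Sum as CommutativeMonoidSum
import Algebra.Properties.Semiring.Sum as SemiringSum
open import Data.Bool using (Bool; true; false; T; not; _∧_; _xor_; if_then_else_)
open import Data.Bool.Properties
  using (xor-∧-commutativeRing; ∧-distribˡ-xor; ∧-assoc; ∧-zeroʳ; ∧-identityʳ; xor-comm; xor-assoc; xor-identityʳ; xor-same; T-∧)
open import Data.Nat using (ℕ; zero; suc; pred; _+_; _*_; _∸_; _≤_; _<_; _≤ᵇ_; _<ᵇ_; z≤n; s≤s)
open import Data.Nat.Properties
  using ( ≤-refl; ≤-trans; ≤-reflexive; <⇒≤; ≮⇒≥; ≤⇒≯; <⇒≱; <-irrefl; <-≤-trans; <-cmp; _≤?_; _<?_; n<1+n; m<n⇒m<1+n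
        ; ≤ᵇ⇒≤; <ᵇ⇒<; <⇒<ᵇ; +-identityʳ; +-mono-≤; +-mono-<; *-monoʳ-≤; *-distribˡ-+; m+[n∸m]≡n; 0∸n≡0
        ; +-0-commutativeMonoid; +-commutativeSemigroup; module ≤-Reasoning )
open import Algebra.Properties.CommutativeSemigroup +-commutativeSemigroup using (xy∙z≈xz∙y)
open import Data.Fin using (Fin; zero; suc; toℕ; fromℕ<; _≟_)
open import Data.Fin.Properties using (toℕ-injective; toℕ<n; toℕ-fromℕ<; suc-injective)
open import Data.Fin.Permutation using (Permutation′; _⟨$⟩ʳ_; _⟨$⟩ˡ_; flip)
open import Data.Empty using (⊥-elim)
open import Data.Product using (_×_; _,_; proj₁; proj₂)
open import Function using (_∘_; Equivalence)
open import Relation.Binary using (tri<; tri≈; tri>)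
open import Relation.Binary.PropositionalEquality
open import Relation.Nullary using (yes; no; contradiction)
open import Relation.Nullary.Decidable using (isYes≗does; dec-true; dec-false)

private
  module 𝔽₂ = CommutativeRing xor-∧-commutativeRing
  module 𝔽₂Sum = SemiringSum 𝔽₂.semiring
  module 𝔽₂CommSum = CommutativeMonoidSum 𝔽₂.+-commutativeMonoid
  module ℕSum = CommutativeMonoidSum +-0-commutativeMonoid

xor≡false⇒≡ : ∀ {x y} → x xor y ≡ false → x ≡ y
xor≡false⇒≡ {false} x⊕y≡0 = sym x⊕y≡0
xor≡false⇒≡ {true} {true} _ = refl

∧-not-partition : ∀ b x → x ≡ (b ∧ x) xor (not b ∧ x)
∧-not-partition true  x = sym (xor-identityʳ x)
∧-not-partition false x = refl

∧-cong-T : ∀ b {x y} → (T b → x ≡ y) → b ∧ x ≡ b ∧ y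
∧-cong-T true  x≡y = x≡y _
∧-cong-T false _   = refl

<ᵇ≡true : ∀ {m n} → m < n → (m <ᵇ n) ≡ true
<ᵇ≡true {m} {n} = dec-true (m <? n)

<ᵇ≡false : ∀ {m n} → n ≤ m → (m <ᵇ n) ≡ false
<ᵇ≡false {m} {n} n≤m = dec-false (m <? n) (≤⇒≯ n≤m)

≤ᵇ≡true : ∀ {m n} → m ≤ n → (m ≤ᵇ n) ≡ true
≤ᵇ≡true {m} {n} = dec-true (m ≤? n)

≤ᵇ≡false : ∀ {m n} → n < m → (m ≤ᵇ n) ≡ false
≤ᵇ≡false {m} {n} n<m = dec-false (m ≤? n) (<⇒≱ n<m)

Σ⊕≡sum : ∀ {n} (f : Fin n → Bool) → Σ⊕ f ≡ 𝔽₂Sum.sum f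
Σ⊕≡sum {zero}  f = refl
Σ⊕≡sum {suc n} f = cong (f zero xor_) (Σ⊕≡sum (f ∘ suc))

Σ⊕-cong : ∀ {n} {f g : Fin n → Bool} → f ≐ g → Σ⊕ f ≡ Σ⊕ g
Σ⊕-cong {zero}  f≐g = refl
Σ⊕-cong {suc n} f≐g = cong₂ _xor_ (f≐g zero) (Σ⊕-cong (f≐g ∘ suc))

Σ⊕-zero : ∀ {n} {f : Fin n → Bool} → f ≐ (λ _ → false) → Σ⊕ f ≡ false
Σ⊕-zero {zero}  f≐0 = refl
Σ⊕-zero {suc n} f≐0 = cong₂ _xor_ (f≐0 zero) (Σ⊕-zero (f≐0 ∘ suc))

Σ⊕-support : ∀ {n} (f : Fin n → Bool) (c : Fin n) → (∀ p → p ≢ c → f p ≡ false) → Σ⊕ f ≡ f c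
Σ⊕-support f zero    off = trans (cong (f zero xor_) (Σ⊕-zero (λ p → off (suc p) λ ()))) (xor-identityʳ (f zero))
Σ⊕-support f (suc c) off = trans (cong (_xor Σ⊕ (f ∘ suc)) (off zero λ ()))
                                 (Σ⊕-support (f ∘ suc) c (λ p p≢c → off (suc p) (p≢c ∘ suc-injective)))

Σ⊕-xor : ∀ {n} (f g : Fin n → Bool) → Σ⊕ (λ i → f i xor g i) ≡ Σ⊕ f xor Σ⊕ g
Σ⊕-xor f g = begin
  Σ⊕ (λ i → f i xor g i)          ≡⟨ Σ⊕≡sum (λ i → f i xor g i) ⟩
  𝔽₂Sum.sum (λ i → f i xor g i)   ≡⟨ 𝔽₂CommSum.∑-distrib-+ f g ⟩
  𝔽₂Sum.sum f xor 𝔽₂Sum.sum g     ≡⟨ cong₂ _xor_ (Σ⊕≡sum f) (Σ⊕≡sum g) ⟨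
  Σ⊕ f xor Σ⊕ g                   ∎
  where open ≡-Reasoning

Σ⊕-∧ˡ : ∀ {n} x (f : Fin n → Bool) → x ∧ Σ⊕ f ≡ Σ⊕ (λ i → x ∧ f i)
Σ⊕-∧ˡ x f = trans (cong (x ∧_) (Σ⊕≡sum f)) (trans (𝔽₂Sum.*-distribˡ-sum x f) (sym (Σ⊕≡sum (λ i → x ∧ f i))))

Σ⊕-∧ʳ : ∀ {n} x (f : Fin n → Bool) → Σ⊕ f ∧ x ≡ Σ⊕ (λ i → f i ∧ x)
Σ⊕-∧ʳ x f = trans (cong (_∧ x) (Σ⊕≡sum f)) (trans (𝔽₂Sum.*-distribʳ-sum x f) (sym (Σ⊕≡sum (λ i → f i ∧ x))))

Σ⊕-comm : ∀ {m n} (f : Fin m → Fin n → Bool) → Σ⊕ (λ i → Σ⊕ (f i)) ≡ Σ⊕ (λ j → Σ⊕ (λ i → f i j))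
Σ⊕-comm f = begin
  Σ⊕ (λ i → Σ⊕ (f i))                            ≡⟨ Σ⊕-cong (λ i → Σ⊕≡sum (f i)) ⟩
  Σ⊕ (λ i → 𝔽₂Sum.sum (f i))                     ≡⟨ Σ⊕≡sum (λ i → 𝔽₂Sum.sum (f i)) ⟩
  𝔽₂Sum.sum (λ i → 𝔽₂Sum.sum (f i))              ≡⟨ 𝔽₂CommSum.∑-comm f ⟩
  𝔽₂Sum.sum (λ j → 𝔽₂Sum.sum (λ i → f i j))      ≡⟨ Σ⊕≡sum (λ j → 𝔽₂Sum.sum (λ i → f i j)) ⟨
  Σ⊕ (λ j → 𝔽₂Sum.sum (λ i → f i j))             ≡⟨ Σ⊕-cong (λ j → Σ⊕≡sum (λ i → f i j)) ⟨
  Σ⊕ (λ j → Σ⊕ (λ i → f i j))                    ∎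
  where open ≡-Reasoning

idM-diagonal : ∀ {n} (j : Fin n) → idM j j ≡ true
idM-diagonal j = trans (isYes≗does (j ≟ j)) (dec-true (j ≟ j) refl)

idM-off-diagonal : ∀ {n} {l j : Fin n} → l ≢ j → idM l j ≡ false
idM-off-diagonal {l = l} {j} l≢j = trans (isYes≗does (l ≟ j)) (dec-false (l ≟ j) l≢j)

Σ⊕-idM : ∀ {n} (x : Fin n → Bool) (j : Fin n) → Σ⊕ (λ l → x l ∧ idM l j) ≡ x j
Σ⊕-idM x j = begin
  Σ⊕ (λ l → x l ∧ idM l j)  ≡⟨ Σ⊕-support _ j (λ l l≢j → trans (cong (x l ∧_) (idM-off-diagonal l≢j)) (∧-zeroʳ (x l))) ⟩
  x j ∧ idM j j             ≡⟨ cong (x j ∧_) (idM-diagonal j) ⟩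
  x j ∧ true                ≡⟨ ∧-identityʳ (x j) ⟩
  x j                       ∎
  where open ≡-Reasoning

Σ⊕-split-last : ∀ {m} (f : Fin m → Bool) (c : Fin m) → (∀ p → toℕ c < toℕ p → f p ≡ false) →
  Σ⊕ f ≡ Σ⊕ (λ p → (toℕ p <ᵇ toℕ c) ∧ f p) xor f c
Σ⊕-split-last {m} f c vanish = begin
  Σ⊕ f                                                           ≡⟨ Σ⊕-cong (λ p → ∧-not-partition (before p) (f p)) ⟩
  Σ⊕ (λ p → (before p ∧ f p) xor (not (before p) ∧ f p))         ≡⟨ Σ⊕-xor (λ p → before p ∧ f p) (λ p → not (before p) ∧ f p) ⟩
  Σ⊕ (λ p → before p ∧ f p) xor Σ⊕ (λ p → not (before p) ∧ f p)  ≡⟨ cong (S xor_) (Σ⊕-support _ c only-c) ⟩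
  S xor (not (before c) ∧ f c)                                   ≡⟨ cong (λ b → S xor (not b ∧ f c)) (<ᵇ≡false (≤-refl {toℕ c})) ⟩
  S xor f c                                                      ∎
  where
  open ≡-Reasoning
  before : Fin m → Bool
  before p = toℕ p <ᵇ toℕ c
  S : Bool
  S = Σ⊕ (λ p → before p ∧ f p)
  only-c : ∀ p → p ≢ c → not (before p) ∧ f p ≡ false
  only-c p p≢c with <-cmp (toℕ p) (toℕ c)
  ... | tri< p<c _ _ = cong (λ b → not b ∧ f p) (<ᵇ≡true p<c)
  ... | tri≈ _ p≡c _ = contradiction (toℕ-injective p≡c) p≢c
  ... | tri> _ _ c<p = trans (cong (not (before p) ∧_) (vanish p c<p)) (∧-zeroʳ _)

·v-distrib-xor : ∀ {r c} (A : Fin r → Fin c → Bool) (x y : Fin c → Bool) →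
  (A ·v (λ j → x j xor y j)) ≐ (λ i → (A ·v x) i xor (A ·v y) i)
·v-distrib-xor A x y i =
  trans (Σ⊕-cong (λ j → ∧-distribˡ-xor (A i j) (x j) (y j))) (Σ⊕-xor (λ j → A i j ∧ x j) (λ j → A i j ∧ y j))

solutions-differ-by-null : ∀ {n} {A : Fin n → Fin n → Bool} {B U V : Fin n → Bool} →
  IsSolution A B U → IsSolution A B V → (A ·v (λ j → U j xor V j)) ≐ (λ _ → false)
solutions-differ-by-null {A = A} {B} {U} {V} solU solV i = begin
  (A ·v (λ j → U j xor V j)) i  ≡⟨ ·v-distrib-xor A U V i ⟩
  (A ·v U) i xor (A ·v V) i     ≡⟨ cong₂ _xor_ (solU i) (solV i) ⟩
  B i xor B i                   ≡⟨ xor-same (B i) ⟩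
  false                         ∎
  where open ≡-Reasoning

solutions-agree-off-support : ∀ {n m} {A : Fin n → Fin n → Bool} {η : Fin n → Fin m → Bool} {B U V : Fin n → Bool} →
  IsNullBasis A η → IsSolution A B U → IsSolution A B V → ∀ j → (∀ l → η j l ≡ false) → U j ≡ V j
solutions-agree-off-support {A = A} {U = U} {V} (_ , spanning , _) solU solV j ηⱼ≡0 =
  let y , U⊕V≐ηy = spanning (λ j → U j xor V j) (solutions-differ-by-null {A = A} solU solV)
  in  xor≡false⇒≡ (trans (U⊕V≐ηy j) (Σ⊕-zero (λ l → cong (_∧ y l) (ηⱼ≡0 l))))

rightInvertible⇒rowKernel-trivial : ∀ {m} {Q Q' : Fin m → Fin m → Bool} → (∀ i j → (Q ·M Q') i j ≡ idM i j) →
  (x : Fin m → Bool) → (∀ c → Σ⊕ (λ l → x l ∧ Q l c) ≡ false) → x ≐ (λ _ → false)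
rightInvertible⇒rowKernel-trivial {Q = Q} {Q'} QQ'≡I x xQ≡0 j = begin
  x j                                                ≡⟨ Σ⊕-idM x j ⟨
  Σ⊕ (λ l → x l ∧ idM l j)                           ≡⟨ Σ⊕-cong (λ l → cong (x l ∧_) (QQ'≡I l j)) ⟨
  Σ⊕ (λ l → x l ∧ Σ⊕ (λ c → Q l c ∧ Q' c j))         ≡⟨ Σ⊕-cong (λ l → Σ⊕-∧ˡ (x l) (λ c → Q l c ∧ Q' c j)) ⟩
  Σ⊕ (λ l → Σ⊕ (λ c → x l ∧ (Q l c ∧ Q' c j)))       ≡⟨ Σ⊕-comm (λ l c → x l ∧ (Q l c ∧ Q' c j)) ⟩
  Σ⊕ (λ c → Σ⊕ (λ l → x l ∧ (Q l c ∧ Q' c j)))       ≡⟨ Σ⊕-cong (λ c → Σ⊕-cong (λ l → ∧-assoc (x l) (Q l c) (Q' c j))) ⟨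
  Σ⊕ (λ c → Σ⊕ (λ l → (x l ∧ Q l c) ∧ Q' c j))       ≡⟨ Σ⊕-cong (λ c → Σ⊕-∧ʳ (Q' c j) (λ l → x l ∧ Q l c)) ⟨
  Σ⊕ (λ c → Σ⊕ (λ l → x l ∧ Q l c) ∧ Q' c j)         ≡⟨ Σ⊕-zero (λ c → cong (_∧ Q' c j) (xQ≡0 c)) ⟩
  false                                              ∎
  where open ≡-Reasoning

echelonRow-output : ∀ {n m} (ε : Fin n → Fin m → Bool) (γ' : Fin n → Bool) (z : Fin m → Bool) (c : Fin m) (r : Fin n) →
  ε r c ≡ true → (∀ p → toℕ c < toℕ p → ε r p ≡ false) →
  (ε ·v z) r xor γ' r ≡ greedyC ε γ' z c r xor z c
echelonRow-output ε γ' z c r pivot right-of-pivot = begin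
  (ε ·v z) r xor γ' r             ≡⟨ cong (_xor γ' r) (Σ⊕-split-last (λ p → ε r p ∧ z p) c right-zero) ⟩
  (S xor (ε r c ∧ z c)) xor γ' r  ≡⟨ cong (λ e → (S xor (e ∧ z c)) xor γ' r) pivot ⟩
  (S xor z c) xor γ' r            ≡⟨ xor-comm (S xor z c) (γ' r) ⟩
  γ' r xor (S xor z c)            ≡⟨ xor-assoc (γ' r) S (z c) ⟨
  (γ' r xor S) xor z c            ∎
  where
  open ≡-Reasoning
  S : Bool
  S = Σ⊕ (λ p → (toℕ p <ᵇ toℕ c) ∧ (ε r p ∧ z p))
  right-zero : ∀ p → toℕ c < toℕ p → ε r p ∧ z p ≡ false
  right-zero p c<p = cong (_∧ z p) (right-of-pivot p c<p)

zeroRow-output : ∀ {n m} {A : Fin n → Fin n → Bool} {B γ V : Fin n → Bool} {η : Fin n → Fin m → Bool}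
  {Q Q' : Fin m → Fin m → Bool} → IsSolution A B γ → IsSolution A B V → IsNullBasis A η →
  (∀ i j → (Q ·M Q') i j ≡ idM i j) → (π : Permutation′ n) (z : Fin m → Bool) (r : Fin n) →
  (∀ p → (permRows π η ·M Q) r p ≡ false) →
  ((permRows π η ·M Q) ·v z) r xor permVec π γ r ≡ permVec π V r
zeroRow-output {γ = γ} {V} {η} {Q} solγ solV null QQ'≡I π z r row-zero = begin
  ((permRows π η ·M Q) ·v z) r xor γ (π ⟨$⟩ʳ r)  ≡⟨ cong (_xor γ (π ⟨$⟩ʳ r)) (Σ⊕-zero (λ p → cong (_∧ z p) (row-zero p))) ⟩
  γ (π ⟨$⟩ʳ r)                                   ≡⟨ solutions-agree-off-support null solγ solV (π ⟨$⟩ʳ r) η-row-zero ⟩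
  V (π ⟨$⟩ʳ r)                                   ∎
  where
  open ≡-Reasoning
  η-row-zero : ∀ l → η (π ⟨$⟩ʳ r) l ≡ false
  η-row-zero = rightInvertible⇒rowKernel-trivial QQ'≡I (η (π ⟨$⟩ʳ r)) row-zero

𝟙 : Bool → ℕ
𝟙 b = if b then 1 else 0

𝟙-mono : ∀ {x y} → (T x → T y) → 𝟙 x ≤ 𝟙 y
𝟙-mono {false}         _   = z≤n
𝟙-mono {true} {true}   _   = ≤-refl
𝟙-mono {true} {false} x⇒y = ⊥-elim (x⇒y _)

count≡sum : ∀ {n} (f : Fin n → Bool) → count f ≡ ℕSum.sum (𝟙 ∘ f)
count≡sum {zero}  f = refl
count≡sum {suc n} f = cong (𝟙 (f zero) +_) (count≡sum (f ∘ suc))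

count-cong : ∀ {n} {f g : Fin n → Bool} → f ≐ g → count f ≡ count g
count-cong {zero}  _   = refl
count-cong {suc n} f≐g = cong₂ _+_ (cong 𝟙 (f≐g zero)) (count-cong (f≐g ∘ suc))

count-mono : ∀ {n} {f g : Fin n → Bool} → (∀ i → T (f i) → T (g i)) → count f ≤ count g
count-mono {zero}  _   = z≤n
count-mono {suc n} f⇒g = +-mono-≤ (𝟙-mono (f⇒g zero)) (count-mono (f⇒g ∘ suc))

count-∧-≤ˡ : ∀ {n} (f g : Fin n → Bool) → count (λ i → f i ∧ g i) ≤ count f
count-∧-≤ˡ f g = count-mono (λ i → proj₁ ∘ Equivalence.to (T-∧ {f i} {g i}))

count-∧-≤ʳ : ∀ {n} (f g : Fin n → Bool) → count (λ i → f i ∧ g i) ≤ count g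
count-∧-≤ʳ f g = count-mono (λ i → proj₂ ∘ Equivalence.to (T-∧ {f i} {g i}))

count-+ : ∀ {n} {f g h : Fin n → Bool} → (∀ i → 𝟙 (h i) ≡ 𝟙 (f i) + 𝟙 (g i)) → count h ≡ count f + count g
count-+ {f = f} {g} {h} 𝟙h≡𝟙f+𝟙g = begin
  count h                               ≡⟨ count≡sum h ⟩
  ℕSum.sum (𝟙 ∘ h)                      ≡⟨ ℕSum.sum-cong-≗ 𝟙h≡𝟙f+𝟙g ⟩
  ℕSum.sum (λ i → 𝟙 (f i) + 𝟙 (g i))    ≡⟨ ℕSum.∑-distrib-+ (𝟙 ∘ f) (𝟙 ∘ g) ⟩
  ℕSum.sum (𝟙 ∘ f) + ℕSum.sum (𝟙 ∘ g)   ≡⟨ cong₂ _+_ (count≡sum f) (count≡sum g) ⟨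
  count f + count g                     ∎
  where open ≡-Reasoning

count-permute : ∀ {n} (π : Permutation′ n) (f : Fin n → Bool) → count (λ i → f (π ⟨$⟩ʳ i)) ≡ count f
count-permute π f = begin
  count (λ i → f (π ⟨$⟩ʳ i))          ≡⟨ count≡sum (λ i → f (π ⟨$⟩ʳ i)) ⟩
  ℕSum.sum (λ i → 𝟙 (f (π ⟨$⟩ʳ i)))   ≡⟨ ℕSum.sum-permute (𝟙 ∘ f) π ⟨
  ℕSum.sum (𝟙 ∘ f)                    ≡⟨ count≡sum f ⟨
  count f                             ∎
  where open ≡-Reasoning

-- inBlock k c unfolds to window (k c) (k (suc c)), and window 0 b r to toℕ r <ᵇ b.
window : ∀ {n} → ℕ → ℕ → Fin n → Bool
window a b r = (a ≤ᵇ toℕ r) ∧ (toℕ r <ᵇ b)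

window⇒bounds : ∀ {n} a b (r : Fin n) → T (window a b r) → a ≤ toℕ r × toℕ r < b
window⇒bounds a b r r∈ab =
  let a≤r , r<b = Equivalence.to T-∧ r∈ab in ≤ᵇ⇒≤ a (toℕ r) a≤r , <ᵇ⇒< (toℕ r) b r<b

window-suc : ∀ {n} a b (r : Fin n) → window a b (suc r) ≡ window (pred a) (pred b) r
window-suc a b r = cong₂ _∧_ (lower a) (upper b)
  where
  lower : ∀ a → (a ≤ᵇ suc (toℕ r)) ≡ (pred a ≤ᵇ toℕ r)
  lower zero          = refl
  lower (suc zero)    = refl
  lower (suc (suc a)) = refl
  upper : ∀ b → (suc (toℕ r) <ᵇ b) ≡ (toℕ r <ᵇ pred b)
  upper zero    = refl
  upper (suc b) = refl

count-window : ∀ {n} a b → count {n} (window a b) ≤ b ∸ a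
count-window {zero}  a b = z≤n
count-window {suc n} a b =
  subst (λ t → 𝟙 (window {suc n} a b zero) + t ≤ b ∸ a) (sym (count-cong {n} (window-suc a b)))
        (head+tail a b (count-window {n} (pred a) (pred b)))
  where
  head+tail : ∀ a b {t} → t ≤ pred b ∸ pred a → 𝟙 (window {suc n} a b zero) + t ≤ b ∸ a
  head+tail zero    zero    t≤ = t≤
  head+tail zero    (suc b) t≤ = s≤s t≤
  head+tail (suc a) zero    t≤ = ≤-trans t≤ (≤-reflexive (0∸n≡0 a))
  head+tail (suc a) (suc b) t≤ = t≤

𝟙-window-split : ∀ {a b c} → a ≤ b → b ≤ c → ∀ t x →
  𝟙 (((a ≤ᵇ t) ∧ (t <ᵇ c)) ∧ x) ≡ 𝟙 (((a ≤ᵇ t) ∧ (t <ᵇ b)) ∧ x) + 𝟙 (((b ≤ᵇ t) ∧ (t <ᵇ c)) ∧ x)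
𝟙-window-split {b = b} a≤b b≤c t x with t <? b
... | yes t<b rewrite <ᵇ≡true t<b | <ᵇ≡true (<-≤-trans t<b b≤c) | ≤ᵇ≡false t<b = sym (+-identityʳ _)
... | no  t≮b rewrite <ᵇ≡false (≮⇒≥ t≮b) | ≤ᵇ≡true (≮⇒≥ t≮b) | ≤ᵇ≡true (≤-trans a≤b (≮⇒≥ t≮b)) = refl

count-window-split : ∀ {n a b c} (f : Fin n → Bool) → a ≤ b → b ≤ c →
  count (λ r → window a c r ∧ f r) ≡ count (λ r → window a b r ∧ f r) + count (λ r → window b c r ∧ f r)
count-window-split f a≤b b≤c = count-+ (λ r → 𝟙-window-split a≤b b≤c (toℕ r) (f r))

count-window-all : ∀ {n b} (f : Fin n → Bool) → n ≤ b → count (λ r → window 0 b r ∧ f r) ≡ count f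
count-window-all f n≤b = count-cong (λ r → cong (_∧ f r) (<ᵇ≡true (<-≤-trans (toℕ<n r) n≤b)))

𝟙-flip-split : ∀ w c → 𝟙 w ≡ 𝟙 (w ∧ (c xor true)) + 𝟙 (w ∧ c)
𝟙-flip-split false c     = refl
𝟙-flip-split true  false = refl
𝟙-flip-split true  true  = refl

majority-flip-≤-half : ∀ {n} (W C : Fin n → Bool) (z : Bool) (d : ℕ) → count W ≤ d →
  z ≡ (d <ᵇ 2 * count (λ i → W i ∧ C i)) → 2 * count (λ i → W i ∧ (C i xor z)) ≤ d
majority-flip-≤-half W C false d _ z≡ = begin
  2 * count (λ i → W i ∧ (C i xor false))  ≡⟨ cong (2 *_) (count-cong (λ i → cong (W i ∧_) (xor-identityʳ (C i)))) ⟩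
  2 * count (λ i → W i ∧ C i)              ≤⟨ ≮⇒≥ (λ d<2h → subst T (sym z≡) (<⇒<ᵇ d<2h)) ⟩
  d                                        ∎
  where open ≤-Reasoning
majority-flip-≤-half W C true d |W|≤d z≡ = ≮⇒≥ λ d<2a → <-irrefl refl (begin-strict
  d + d          <⟨ +-mono-< d<2a d<2h ⟩
  2 * a + 2 * h  ≡⟨ *-distribˡ-+ 2 a h ⟨
  2 * (a + h)    ≡⟨ cong (2 *_) (count-+ (λ i → 𝟙-flip-split (W i) (C i))) ⟨
  2 * count W    ≤⟨ *-monoʳ-≤ 2 |W|≤d ⟩
  2 * d          ≡⟨ cong (d +_) (+-identityʳ d) ⟩
  d + d          ∎)
  where
  open ≤-Reasoning
  a h : ℕ
  a = count (λ i → W i ∧ (C i xor true))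
  h = count (λ i → W i ∧ C i)
  d<2h : d < 2 * h
  d<2h = <ᵇ⇒< d (2 * h) (subst T z≡ _)

prefix-bound : ∀ {n} (k : ℕ → ℕ) (m : ℕ) (w v : Fin n → Bool) →
  (∀ i → i < m → k i ≤ k (suc i)) →
  (∀ r → toℕ r < k 0 → w r ≡ v r) →
  (∀ i → i < m → 2 * count (λ r → window (k i) (k (suc i)) r ∧ w r) ≤ k (suc i) ∸ k i) →
  2 * count (λ r → window 0 (k m) r ∧ w r) ≤ k m + count v
prefix-bound {n} k zero w v _ agree _ = begin
  2 * count (λ r → window 0 (k 0) r ∧ w r)  ≡⟨ cong (2 *_) (count-cong w≐v) ⟩
  2 * x                                     ≡⟨ cong (x +_) (+-identityʳ x) ⟩
  x + x                                     ≤⟨ +-mono-≤ x≤k₀ (count-∧-≤ʳ (window 0 (k 0)) v) ⟩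
  k 0 + count v                             ∎
  where
  open ≤-Reasoning
  x : ℕ
  x = count (λ r → window 0 (k 0) r ∧ v r)
  w≐v : ∀ r → window 0 (k 0) r ∧ w r ≡ window 0 (k 0) r ∧ v r
  w≐v r = ∧-cong-T (window 0 (k 0) r) (agree r ∘ <ᵇ⇒< (toℕ r) (k 0))
  x≤k₀ : x ≤ k 0
  x≤k₀ = ≤-trans (count-∧-≤ˡ (window 0 (k 0)) v) (count-window {n} 0 (k 0))
prefix-bound k (suc m) w v mono agree blocks = begin
  2 * count (λ r → window 0 (k (suc m)) r ∧ w r)  ≡⟨ cong (2 *_) (count-window-split w z≤n kₘ≤kₘ₊₁) ⟩
  2 * (P + L)                                     ≡⟨ *-distribˡ-+ 2 P L ⟩
  2 * P + 2 * L                                   ≤⟨ +-mono-≤ prefix (blocks m (n<1+n m)) ⟩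
  k m + count v + (k (suc m) ∸ k m)               ≡⟨ xy∙z≈xz∙y (k m) (count v) (k (suc m) ∸ k m) ⟩
  k m + (k (suc m) ∸ k m) + count v               ≡⟨ cong (_+ count v) (m+[n∸m]≡n kₘ≤kₘ₊₁) ⟩
  k (suc m) + count v                             ∎
  where
  open ≤-Reasoning
  kₘ≤kₘ₊₁ : k m ≤ k (suc m)
  kₘ≤kₘ₊₁ = mono m (n<1+n m)
  P L : ℕ
  P = count (λ r → window 0 (k m) r ∧ w r)
  L = count (λ r → window (k m) (k (suc m)) r ∧ w r)
  prefix : 2 * P ≤ k m + count v
  prefix = prefix-bound k m w v (λ i → mono i ∘ m<n⇒m<1+n) agree (λ i → blocks i ∘ m<n⇒m<1+n)

blockwise-bound : ∀ {n} (k : ℕ → ℕ) (m : ℕ) (w v : Fin n → Bool) →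
  (∀ i → i < m → k i ≤ k (suc i)) → k m ≡ n →
  (∀ r → toℕ r < k 0 → w r ≡ v r) →
  (∀ i → i < m → 2 * count (λ r → window (k i) (k (suc i)) r ∧ w r) ≤ k (suc i) ∸ k i) →
  2 * count w ≤ n + count v
blockwise-bound {n} k m w v mono kₘ≡n agree blocks = begin
  2 * count w                               ≡⟨ cong (2 *_) (count-window-all w (≤-reflexive (sym kₘ≡n))) ⟨
  2 * count (λ r → window 0 (k m) r ∧ w r)  ≤⟨ prefix-bound k m w v mono agree blocks ⟩
  k m + count v                             ≡⟨ cong (_+ count v) kₘ≡n ⟩
  n + count v                               ∎
  where open ≤-Reasoning

greedy-block-bound : ∀ {n m} {ε : Fin n → Fin m → Bool} {k : ℕ → ℕ} {γ' : Fin n → Bool} {z : Fin m → Bool} →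
  IsColEchelon ε k → IsGreedyChoice ε k γ' z → (c : Fin m) →
  2 * count (λ r → inBlock k c r ∧ ((ε ·v z) r xor γ' r)) ≤ k (suc (toℕ c)) ∸ k (toℕ c)
greedy-block-bound {n} {ε = ε} {k} {γ'} {z} (_ , _ , _ , blocks) greedy c = begin
  2 * count (λ r → inBlock k c r ∧ ((ε ·v z) r xor γ' r))         ≡⟨ cong (2 *_) (count-cong (λ r → ∧-cong-T (inBlock k c r) (output r))) ⟩
  2 * count (λ r → inBlock k c r ∧ (greedyC ε γ' z c r xor z c))  ≤⟨ majority-flip-≤-half (inBlock k c) (greedyC ε γ' z c) (z c) _
                                                                       (count-window {n} (k (toℕ c)) (k (suc (toℕ c)))) (greedy c) ⟩
  k (suc (toℕ c)) ∸ k (toℕ c)                                     ∎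
  where
  open ≤-Reasoning
  output : ∀ r → T (inBlock k c r) → (ε ·v z) r xor γ' r ≡ greedyC ε γ' z c r xor z c
  output r r∈c = let lo , hi = window⇒bounds (k (toℕ c)) (k (suc (toℕ c))) r r∈c
                     pivot , right-of-pivot = blocks c r lo hi
                 in  echelonRow-output ε γ' z c r pivot right-of-pivot

proposition5 : (n : ℕ) (G : LampGraph n) (B : Fin n → Bool)
    (γ : Fin n → Bool) → IsSolution (modAdj G) B γ →
    (m : ℕ) (η : Fin n → Fin m → Bool) → IsNullBasis (modAdj G) η →
    (π : Permutation′ n) (Q : Fin m → Fin m → Bool) → Invertible Q →
    (k : ℕ → ℕ) → IsColEchelon (permRows π η ·M Q) k →
    (z : Fin m → Bool) → IsGreedyChoice (permRows π η ·M Q) k (permVec π γ) z →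
    (V : Fin n → Bool) → IsSolution (modAdj G) B V →
    2 * value (greedyOutput π (permRows π η ·M Q) (permVec π γ) z) ≤ n + value V
proposition5 n G B γ solγ m η null π Q (Q' , QQ'≡I , _) k echelon@(k-increasing , kₘ≡n , zero-rows , _) z greedy V solV =
  begin
    2 * count (λ s → w (π ⟨$⟩ˡ s))  ≡⟨ cong (2 *_) (count-permute (flip π) w) ⟩
    2 * count w                     ≤⟨ blockwise-bound k m w V' (λ i → <⇒≤ ∘ k-increasing i) kₘ≡n agree blocks ⟩
    n + count V'                    ≡⟨ cong (n +_) (count-permute π V) ⟩
    n + value V                     ∎
  where
  open ≤-Reasoning
  ε : Fin n → Fin m → Bool
  ε = permRows π η ·M Q
  w V' : Fin n → Bool
  w r = (ε ·v z) r xor permVec π γ r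
  V' = permVec π V
  agree : ∀ r → toℕ r < k 0 → w r ≡ V' r
  agree r r<k₀ = zeroRow-output solγ solV null QQ'≡I π z r (zero-rows r r<k₀)
  blocks : ∀ i → i < m → 2 * count (λ r → window (k i) (k (suc i)) r ∧ w r) ≤ k (suc i) ∸ k i
  blocks i i<m = subst (λ j → 2 * count (λ r → window (k j) (k (suc j)) r ∧ w r) ≤ k (suc j) ∸ k j)
                       (toℕ-fromℕ< i<m) (greedy-block-bound echelon greedy (fromℕ< i<m))
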